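{- A star graph satisfies the neighbour sum property if and only if it has exactly one edge.
   Context: A star graph consists of a central vertex $v_0$ and $n\geq 1$ further vertices (leaves), each adjacent only to $v_0$. A graph $\mathcal G=(\mathcal V,\mathcal E)$ satisfies the neighbour sum property if there exists $f:\mathcal V\to\mathbb R$ with $f\not\equiv 0$ such that $f(x)=\sum_{y:\{x,y\}\in\mathcal E} f(y)$ for every $x\in\mathcal V$. -}

module Defs where

open import Level using (0ℓ)
open import Data.Nat using (ℕ; zero; suc)
import Data.Nat as ℕ
open import Data.Fin using (Fin; zero; suc; toℕ)
open import Data.Bool using (Bool; true; false; if_then_else_)
open import Data.Product using (Σ; ∃; _×_; _,_)
open import Relation.Nullary using (¬_; does)
open import Algebra.Structures using (IsCommutativeRing)
open import Relation.Binary.Structures using (IsTotalOrder)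

-- The real numbers, axiomatised as a (Dedekind-)complete ordered field.
-- (agda-stdlib has no real numbers; the theorem is stated for every
-- model of these axioms, in particular for ℝ.)

record RealField : Set₁ where
  infix  4 _≈_ _≤_
  infixl 6 _+_
  infixl 7 _*_
  field
    Carrier : Set
    _≈_     : Carrier → Carrier → Set
    _+_     : Carrier → Carrier → Carrier
    _*_     : Carrier → Carrier → Carrier
    -_      : Carrier → Carrier
    0#      : Carrier
    1#      : Carrier
    _≤_     : Carrier → Carrier → Set
    isCommutativeRing : IsCommutativeRing _≈_ _+_ _*_ -_ 0# 1#
    0≉1     : ¬ (0# ≈ 1#)
    inverse : ∀ x → ¬ (x ≈ 0#) → ∃ λ y → x * y ≈ 1#
    isTotalOrder : IsTotalOrder _≈_ _≤_
    +-mono-≤ : ∀ {x y} z → x ≤ y → x + z ≤ y + z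
    *-nonneg : ∀ {x y} → 0# ≤ x → 0# ≤ y → 0# ≤ x * y
    complete : (P : Carrier → Set) → ∃ P →
               (∃ λ b → ∀ x → P x → x ≤ b) →
               ∃ λ s → (∀ x → P x → x ≤ s) ×
                       (∀ b → (∀ x → P x → x ≤ b) → s ≤ b)

-- Finite simple graphs on vertex set Fin m, given by a (symmetric,
-- irreflexive) Boolean adjacency relation.

Adjacency : ℕ → Set
Adjacency m = Fin m → Fin m → Bool

sumℕ : ∀ {m} → (Fin m → ℕ) → ℕ
sumℕ {zero}  g = 0
sumℕ {suc m} g = g zero ℕ.+ sumℕ (λ i → g (suc i))

edgeCount : ∀ {m} → Adjacency m → ℕ
edgeCount adj =
  sumℕ λ i → sumℕ λ j →
    if does (toℕ i ℕ.<? toℕ j) then (if adj i j then 1 else 0) else 0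

-- star graph with n leaves: vertex zero is the centre v₀,
-- vertices suc i are the leaves, each adjacent only to v₀.
star : (n : ℕ) → Adjacency (suc n)
star n zero    zero    = false
star n zero    (suc _) = true
star n (suc _) zero    = true
star n (suc _) (suc _) = false

module _ (R : RealField) where
  open RealField R

  sumR : ∀ {m} → (Fin m → Carrier) → Carrier
  sumR {zero}  g = 0#
  sumR {suc m} g = g zero + sumR (λ i → g (suc i))

  neighbourSum : ∀ {m} → Adjacency m → (Fin m → Carrier) → Fin m → Carrier
  neighbourSum adj f x = sumR λ y → if adj x y then f y else 0#

  NeighbourSumProperty : ∀ {m} → Adjacency m → Set
  NeighbourSumProperty {m} adj =
    Σ (Fin m → Carrier) λ f →
      (∃ λ x → ¬ (f x ≈ 0#)) × (∀ x → f x ≈ neighbourSum adj f x)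

-- At a leaf the neighbour sum equation says f(leaf) = f(v₀), so the equation
-- at the centre becomes f(v₀) = n · f(v₀). In an ordered field n · x = x forces
-- x = 0 unless n = 1, so a nonzero solution exists exactly for n = 1 (where the
-- constant function 1 works), and the star with n leaves has n edges.
module Submission where

open import Defs
open import Data.Nat as ℕ using (ℕ; zero; suc; _≤_; _<?_; _≟_)
import Data.Nat.Properties as ℕ
open import Data.Bool using (if_then_else_)
open import Data.Bool.Properties using (if-eta)
open import Data.Fin using (Fin; zero; suc; toℕ)
open import Data.Product using (_,_)
open import Data.Sum using (inj₁; inj₂)
open import Function.Bundles using (_⇔_; mk⇔)
open import Relation.Nullary using (¬_; does; yes; no; contradiction)
open import Relation.Binary.PropositionalEquality
  using (_≡_; _≢_; refl; cong; cong₂; subst; sym; module ≡-Reasoning)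
open import Algebra.Bundles using (CommutativeRing)
open import Relation.Binary.Structures using (IsTotalOrder)
import Algebra.Properties.Ring as RingProperties
import Algebra.Properties.Monoid.Sum as MonoidSum
import Algebra.Properties.Semiring.Mult as SemiringMult
import Relation.Binary.Reasoning.Setoid as SetoidReasoning

sumℕ-zero : ∀ {m} {g : Fin m → ℕ} → (∀ i → g i ≡ 0) → sumℕ g ≡ 0
sumℕ-zero {zero}  g≡0 = refl
sumℕ-zero {suc m} g≡0 = cong₂ ℕ._+_ (g≡0 zero) (sumℕ-zero (λ i → g≡0 (suc i)))

sumℕ-ones : ∀ m → sumℕ {m} (λ _ → 1) ≡ m
sumℕ-ones zero    = refl
sumℕ-ones (suc m) = cong₂ ℕ._+_ refl (sumℕ-ones m)

edgeIndicator : ∀ {m} → Adjacency m → Fin m → Fin m → ℕ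
edgeIndicator adj i j = if does (toℕ i <? toℕ j) then (if adj i j then 1 else 0) else 0

-- Each edge is counted from its smaller endpoint, which is always the centre zero.
edgeCount-star : ∀ n → edgeCount (star n) ≡ n
edgeCount-star n = begin
  edgeCount (star n) ≡⟨ cong₂ ℕ._+_ (sumℕ-ones n) (sumℕ-zero λ i → sumℕ-zero (leafRow i)) ⟩
  n ℕ.+ 0            ≡⟨ ℕ.+-identityʳ n ⟩
  n                  ∎
  where
  open ≡-Reasoning
  leafRow : ∀ i j → edgeIndicator (star n) (suc i) j ≡ 0
  leafRow i zero    = refl
  leafRow i (suc j) = if-eta _

module _ (R : RealField) where
  open RealField R hiding (_≤_)
  open RealField R using () renaming (_≤_ to _≤ᴿ_)

  commutativeRing : CommutativeRing _ _
  commutativeRing = record { isCommutativeRing = isCommutativeRing }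

  open CommutativeRing commutativeRing
    using ( setoid; ring; semiring; +-monoid
          ; +-comm; +-congˡ; *-congˡ; *-congʳ; *-assoc; *-comm
          ; +-identityˡ; +-identityʳ; *-identityˡ; *-identityʳ; zeroˡ; -‿inverseʳ )
    renaming (refl to ≈-refl; sym to ≈-sym; trans to ≈-trans)
  open RingProperties ring using (-1*x≈-x; -‿involutive; +-identityʳ-unique)
  open MonoidSum +-monoid using (sum; sum-cong-≋; sum-replicate; sum-replicate-zero)
  open SemiringMult semiring using (_×_; ×-congʳ; ×-assoc-*)
  open IsTotalOrder isTotalOrder using (total; antisym; ≤-respˡ-≈; ≤-respʳ-≈)
    renaming (trans to ≤-trans; reflexive to ≤-reflexive)
  open SetoidReasoning setoid

  sumR≡sum : ∀ {m} (g : Fin m → Carrier) → sumR R g ≡ sum g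
  sumR≡sum {zero}  g = refl
  sumR≡sum {suc m} g = cong (g zero +_) (sumR≡sum (λ i → g (suc i)))

  -- If 1 ≤ 0 then 0 ≤ -1, and then 0 ≤ (-1)·(-1) ≈ 1.
  0≤1 : 0# ≤ᴿ 1#
  0≤1 with total 0# 1#
  ... | inj₁ 0≤1 = 0≤1
  ... | inj₂ 1≤0 = ≤-respʳ-≈ (≈-trans (-1*x≈-x (- 1#)) (-‿involutive 1#)) (*-nonneg 0≤-1 0≤-1)
    where
    0≤-1 : 0# ≤ᴿ - 1#
    0≤-1 = ≤-respʳ-≈ (+-identityˡ _) (≤-respˡ-≈ (-‿inverseʳ 1#) (+-mono-≤ (- 1#) 1≤0))

  x≤x+y : ∀ {x y} → 0# ≤ᴿ y → x ≤ᴿ x + y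
  x≤x+y {x} {y} 0≤y = ≤-respˡ-≈ (+-identityˡ x) (≤-respʳ-≈ (+-comm y x) (+-mono-≤ x 0≤y))

  0≤n×1 : ∀ n → 0# ≤ᴿ n × 1#
  0≤n×1 zero    = ≤-reflexive ≈-refl
  0≤n×1 (suc n) = ≤-trans 0≤1 (x≤x+y (0≤n×1 n))

  suc×1≉0 : ∀ n → ¬ (suc n × 1# ≈ 0#)
  suc×1≉0 n 1+n≈0 = 0≉1 (antisym 0≤1 (≤-respʳ-≈ 1+n≈0 (x≤x+y (0≤n×1 n))))

  x≉0⇒x*y≈0⇒y≈0 : ∀ {x y} → ¬ (x ≈ 0#) → x * y ≈ 0# → y ≈ 0#
  x≉0⇒x*y≈0⇒y≈0 {x} {y} x≉0 xy≈0 with inverse x x≉0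
  ... | x⁻¹ , xx⁻¹≈1 = begin
    y             ≈⟨ ≈-sym (*-identityʳ y) ⟩
    y * 1#        ≈⟨ *-congˡ (≈-sym xx⁻¹≈1) ⟩
    y * (x * x⁻¹) ≈⟨ ≈-sym (*-assoc y x x⁻¹) ⟩
    (y * x) * x⁻¹ ≈⟨ *-congʳ (≈-trans (*-comm y x) xy≈0) ⟩
    0# * x⁻¹      ≈⟨ zeroˡ x⁻¹ ⟩
    0#            ∎

  suc×x≈0⇒x≈0 : ∀ n {x} → suc n × x ≈ 0# → x ≈ 0#
  suc×x≈0⇒x≈0 n {x} n×x≈0 = x≉0⇒x*y≈0⇒y≈0 (suc×1≉0 n) (begin
    suc n × 1# * x   ≈⟨ ×-assoc-* (suc n) 1# x ⟩
    suc n × (1# * x) ≈⟨ ×-congʳ (suc n) (*-identityˡ x) ⟩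
    suc n × x        ≈⟨ n×x≈0 ⟩
    0#               ∎)

  x≈n×x⇒x≈0 : ∀ n {x} → n ≢ 1 → x ≈ n × x → x ≈ 0#
  x≈n×x⇒x≈0 zero          _   x≈0   = x≈0
  x≈n×x⇒x≈0 (suc zero)    n≢1 _     = contradiction refl n≢1
  x≈n×x⇒x≈0 (suc (suc m)) _   x≈x+y = suc×x≈0⇒x≈0 m (+-identityʳ-unique _ _ (≈-sym x≈x+y))

  NeighbourSumSolution : ∀ {m} → Adjacency m → (Fin m → Carrier) → Set
  NeighbourSumSolution adj f = ∀ x → f x ≈ neighbourSum R adj f x

  module _ {n} {f : Fin (suc n) → Carrier} (solves : NeighbourSumSolution (star n) f) where

    leaf≈centre : ∀ i → f (suc i) ≈ f zero
    leaf≈centre i = begin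
      f (suc i)                      ≈⟨ solves (suc i) ⟩
      f zero + sumR R {n} (λ _ → 0#) ≡⟨ cong (f zero +_) (sumR≡sum {n} _) ⟩
      f zero + sum {n} (λ _ → 0#)    ≈⟨ +-congˡ (sum-replicate-zero n) ⟩
      f zero + 0#                    ≈⟨ +-identityʳ (f zero) ⟩
      f zero                         ∎

    centre≈n×centre : f zero ≈ n × f zero
    centre≈n×centre = begin
      f zero                        ≈⟨ solves zero ⟩
      0# + sumR R (λ i → f (suc i)) ≈⟨ +-identityˡ _ ⟩
      sumR R (λ i → f (suc i))      ≡⟨ sumR≡sum {n} _ ⟩
      sum (λ i → f (suc i))         ≈⟨ sum-cong-≋ leaf≈centre ⟩
      sum {n} (λ _ → f zero)        ≈⟨ sum-replicate n ⟩
      n × f zero                    ∎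

    star-solution≈0 : n ≢ 1 → ∀ x → f x ≈ 0#
    star-solution≈0 n≢1 zero    = x≈n×x⇒x≈0 n n≢1 centre≈n×centre
    star-solution≈0 n≢1 (suc i) = ≈-trans (leaf≈centre i) (star-solution≈0 n≢1 zero)

  star1-neighbourSumProperty : NeighbourSumProperty R (star 1)
  star1-neighbourSumProperty = (λ _ → 1#) , (zero , λ 1≈0 → 0≉1 (≈-sym 1≈0)) , solves
    where
    solves : NeighbourSumSolution (star 1) (λ _ → 1#)
    solves zero       = ≈-sym (≈-trans (+-identityˡ _) (+-identityʳ 1#))
    solves (suc zero) = ≈-sym (≈-trans (+-congˡ (+-identityʳ 0#)) (+-identityʳ 1#))

  star-neighbourSumProperty⇔ : ∀ n → NeighbourSumProperty R (star n) ⇔ n ≡ 1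
  star-neighbourSumProperty⇔ n = mk⇔ to from
    where
    to : NeighbourSumProperty R (star n) → n ≡ 1
    to (f , (x , fx≉0) , solves) with n ≟ 1
    ... | yes n≡1 = n≡1
    ... | no  n≢1 = contradiction (star-solution≈0 solves n≢1 x) fx≉0

    from : n ≡ 1 → NeighbourSumProperty R (star n)
    from n≡1 = subst (λ k → NeighbourSumProperty R (star k)) (sym n≡1) star1-neighbourSumProperty

corollary3p3 : (R : RealField) (n : ℕ) → 1 ≤ n →
    (NeighbourSumProperty R (star n) ⇔ (edgeCount (star n) ≡ 1))
corollary3p3 R n _ =
  subst (λ k → NeighbourSumProperty R (star n) ⇔ k ≡ 1)
        (sym (edgeCount-star n))
        (star-neighbourSumProperty⇔ R n)
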